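{- Let $m\ge1$ and $n\ge m+2$ be integers. Let $\tilde{\mathcal I}$ be the family of non-empty independent sets $I$ of $P_n^m$ with $m(I)\le m+1$ and $M(I)\ge n-m$. Then for every $I\in\tilde{\mathcal I}$, $$\gamma_{gr}(P_n^m,I)=M(I)-m(I)+1-(|I|-1)m.$$ Moreover, for every non-empty independent set $I$ of $P_n^m$ there exists $I'\in\tilde{\mathcal I}$ such that $\gamma_{gr}(P_n^m,I)\le\gamma_{gr}(P_n^m,I')$.
   Context: $P_n$ is the path on $[n]$ with edges $\{i,i+1\}$, $i\in[n-1]$; $P_n^m$ is its $m$-th power (two vertices adjacent iff $|i-j|\le m$). For $I\subseteq[n]$ non-empty, $m(I)=\min I$ and $M(I)=\max I$. For a sequence $S=(v_1,\dots,v_k)$ of distinct vertices, $PN_S(v_i)=N[v_i]\setminus\bigcup_{j<i}N[v_j]$; $S$ is legal dominating if $\{v_1,\dots,v_k\}$ dominates the graph and each $PN_S(v_i)\ne\emptyset$. The footprinter $f_S(x)$ of a vertex $x$ is the unique $v_i$ with $x\in PN_S(v_i)$; $I_S=\{x:f_S(x)=x\}$. For an independent set $I$, $\gamma_{gr}(G,I)=\max\{|S|: S\text{ legal dominating sequence of } G,\ I_S=I\}$ (with $\max\emptyset=-\infty$). -}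

module Defs where

open import Data.Nat using (ℕ; _≤_; _<_; _+_; _∸_; ∣_-_∣)
open import Data.Integer as ℤ using (ℤ; +_)
open import Data.List using (List; length; lookup)
open import Data.List.NonEmpty as L⁺ using (List⁺; head; last; toList)
open import Data.List.Membership.Propositional using (_∈_)
open import Data.List.Relation.Unary.All using (All)
open import Data.List.Relation.Unary.Linked using (Linked)
open import Data.List.Relation.Unary.Unique.Propositional using (Unique)
open import Data.Fin using (Fin; toℕ)
open import Data.Product using (Σ; _×_; ∃)
open import Relation.Binary.PropositionalEquality using (_≡_; _≢_)
open import Relation.Nullary using (¬_)
open import Function.Bundles using (_⇔_)

-- Graph P_n^m on vertex set [n] = {1,…,n}; N[v] = {x ∈ [n] : |x - v| ≤ m}.
InV : ℕ → ℕ → Set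
InV n x = 1 ≤ x × x ≤ n

InN : ℕ → ℕ → ℕ → ℕ → Set
InN n m v x = InV n x × ∣ x - v ∣ ≤ m

InPN : ℕ → ℕ → (S : List ℕ) → Fin (length S) → ℕ → Set
InPN n m S i x =
  InN n m (lookup S i) x × (∀ (j : Fin (length S)) → toℕ j < toℕ i → ¬ InN n m (lookup S j) x)

LegalDom : ℕ → ℕ → List ℕ → Set
LegalDom n m S =
  Unique S × All (InV n) S
  × (∀ x → InV n x → Σ (Fin (length S)) λ i → InN n m (lookup S i) x)
  × (∀ (i : Fin (length S)) → ∃ λ x → InPN n m S i x)

FootSelf : ℕ → ℕ → List ℕ → ℕ → Set
FootSelf n m S x = Σ (Fin (length S)) λ i → lookup S i ≡ x × InPN n m S i x

-- I_S = I (I given as a non-empty list, understood as a set)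
ISeq : ℕ → ℕ → List ℕ → List⁺ ℕ → Set
ISeq n m S I = ∀ x → FootSelf n m S x ⇔ x ∈ toList I

-- non-empty independent set of P_n^m, represented canonically as a strictly
-- increasing non-empty list of vertices
IndepSet : ℕ → ℕ → List⁺ ℕ → Set
IndepSet n m I =
  Linked _<_ (toList I) × All (InV n) (toList I)
  × (∀ x y → x ∈ toList I → y ∈ toList I → x ≢ y → m < ∣ x - y ∣)

minI maxI card : List⁺ ℕ → ℕ
minI = head
maxI = last
card = L⁺.length

GammaGrIs : ℕ → ℕ → List⁺ ℕ → ℤ → Set
GammaGrIs n m I k =
  (∃ λ S → LegalDom n m S × ISeq n m S I × (+ length S) ≡ k)
  × (∀ S → LegalDom n m S → ISeq n m S I → (+ length S) ℤ.≤ k)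

-- γ_gr(P_n^m, I) ≤ γ_gr(P_n^m, I')  (with max ∅ = -∞; the maxima are over
-- finite sets, so this is: every candidate for I is beaten by one for I')
GammaGrLe : ℕ → ℕ → List⁺ ℕ → List⁺ ℕ → Set
GammaGrLe n m I I' =
  ∀ S → LegalDom n m S → ISeq n m S I →
    ∃ λ S' → LegalDom n m S' × ISeq n m S' I' × length S ≤ length S'

InTilde : ℕ → ℕ → List⁺ ℕ → Set
InTilde n m I = IndepSet n m I × minI I ≤ m + 1 × n ∸ m ≤ maxI I

formula : ℕ → List⁺ ℕ → ℤ
formula m I = ((+ maxI I) ℤ.- (+ minI I) ℤ.+ + 1) ℤ.- ((+ card I) ℤ.- + 1) ℤ.* (+ m)

module Submission where

-- The greedy sequence of I lists increasingly every x with min I ≤ x ≤ max I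
-- such that no element of I lies in (x, x + m]: a block [c, c' − m) for each consecutive pair
-- c, c' of I, followed by max I, so it has M(I) − m(I) + 1 − (|I| − 1)m elements. Each of its
-- vertices has x + m (or n) as a private neighbour, and exactly the elements of I are their own
-- footprinters; when m(I) ≤ m + 1 and M(I) ≥ n − m it also dominates, so it is a legal sequence.
--
-- Conversely, let S be legal with I_S = I. To each vertex s of S assign a point z: s itself when
-- it is self-footprinted, and otherwise a private neighbour x of s, or x − m when x lies to the
-- right of s. As private neighbourhoods are disjoint these points are distinct; an element of I
-- inside (z, z + m] would be near both s and that neighbour, which contradicts it being its own
-- footprinter. So each z is a vertex of the greedy sequence of the completion I' of I by 1 and
-- n, whence |S| is at most the greedy count of I'; and I' = I when I ∈ Ĩ.

open import Data.Empty using (⊥; ⊥-elim)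
open import Data.Fin as Fin using (Fin; toℕ; zero; suc)
import Data.Fin.Properties as Fin
open import Data.Integer as ℤ using (+_)
import Data.Integer.Properties as ℤ
open import Data.Integer.Tactic.RingSolver renaming (solve-∀ to ℤ-solve-∀)
open import Data.List as List using (List; []; _∷_; _++_; _∷ʳ_; length; lookup; applyUpTo)
open import Data.List.Properties using (length-++; length-applyUpTo)
open import Data.List.NonEmpty as L⁺ using (List⁺; _∷_)
open import Data.List.Membership.Propositional using (_∈_; _∉_)
open import Data.List.Membership.Propositional.Properties
  using (∈-++⁺ˡ; ∈-++⁺ʳ; ∈-++⁻; ∈-lookup; ∈-applyUpTo⁺; ∈-applyUpTo⁻)
open import Data.List.Relation.Unary.All as All using (All; []; _∷_)
open import Data.List.Relation.Unary.All.Properties using (applyUpTo⁺₁)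
open import Data.List.Relation.Unary.AllPairs as AllPairs using (AllPairs; []; _∷_)
import Data.List.Relation.Unary.AllPairs.Properties as AllPairs
open import Data.List.Relation.Unary.Any as Any using (here; there)
open import Data.List.Relation.Unary.Any.Properties using (lookup-index)
open import Data.List.Relation.Unary.Linked as Linked using (Linked)
open import Data.List.Relation.Unary.Linked.Properties using (Linked⇒AllPairs)
open import Data.Nat
open import Data.Nat.Properties
open import Data.Nat.Tactic.RingSolver using (solve-∀)
open import Data.List.Membership.DecPropositional _≟_ using (_∈?_)
open import Data.Product using (Σ; ∃; _×_; _,_; proj₁; proj₂; map; uncurry)
open import Data.Sum as Sum using (_⊎_; inj₁; inj₂; [_,_])
open import Function using (_∘_; id; case_of_)
open import Function.Bundles using (mk⇔; module Equivalence)
open import Relation.Binary.Definitions using (tri<; tri≈; tri>)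
open import Relation.Binary.PropositionalEquality hiding ([_])
open import Relation.Nullary using (¬_; Dec; yes; no; ¬?)
open import Relation.Nullary.Decidable using (_×-dec_; decidable-stable; toSum)

open import Defs

AllPairs-either : ∀ {R : ℕ → ℕ → Set} {xs x y} →
                  AllPairs R xs → x ∈ xs → y ∈ xs → x ≢ y → R x y ⊎ R y x
AllPairs-either (_ ∷ _) (here refl) (here refl) x≢y = ⊥-elim (x≢y refl)
AllPairs-either (h ∷ _) (here refl) (there q)   _   = inj₁ (All.lookup h q)
AllPairs-either (h ∷ _) (there p)   (here refl) _   = inj₂ (All.lookup h p)
AllPairs-either (_ ∷ t) (there p)   (there q)   x≢y = AllPairs-either t p q x≢y

AllPairs-lookup : ∀ {R : ℕ → ℕ → Set} {xs} → AllPairs R xs →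
                  ∀ (i j : Fin (length xs)) → toℕ i < toℕ j → R (lookup xs i) (lookup xs j)
AllPairs-lookup (h ∷ _) zero    (suc j) _         = All.lookup h (∈-lookup j)
AllPairs-lookup (_ ∷ t) (suc i) (suc j) (s≤s i<j) = AllPairs-lookup t i j i<j

applyUpTo-sorted : ∀ (f : ℕ → ℕ) k → (∀ {i j} → i < j → f i < f j) → AllPairs _<_ (applyUpTo f k)
applyUpTo-sorted f zero    _    = []
applyUpTo-sorted f (suc k) mono = applyUpTo⁺₁ (f ∘ suc) k (λ _ → mono z<s)
                                ∷ applyUpTo-sorted (f ∘ suc) k (mono ∘ s<s)

injection⇒≤length : ∀ {k} (L : List ℕ) (f : Fin k → ℕ) →
                    (∀ i j → f i ≡ f j → i ≡ j) → (∀ i → f i ∈ L) → k ≤ length L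
injection⇒≤length {k} L f f-inj f∈L with k ≤? length L
... | yes k≤ = k≤
... | no k≰ with Fin.pigeonhole (≰⇒> k≰) (Any.index ∘ f∈L)
...   | i , j , i<j , same-index = ⊥-elim (<⇒≢ i<j (cong toℕ (f-inj i j f-eq)))
  where
  f-eq : f i ≡ f j
  f-eq = trans (lookup-index (f∈L i)) (trans (cong (lookup L) same-index) (sym (lookup-index (f∈L j))))

count≡formula : ∀ m L a r M → L + r * m + a ≡ suc M →
                + L ≡ ((+ M) ℤ.- (+ a) ℤ.+ + 1) ℤ.- ((+ suc r) ℤ.- + 1) ℤ.* (+ m)
count≡formula m L a r M eq = sym (begin
  ((+ M) ℤ.- (+ a) ℤ.+ + 1) ℤ.- ((+ suc r) ℤ.- + 1) ℤ.* (+ m)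
    ≡⟨ cong (λ k → ((+ M) ℤ.- (+ a) ℤ.+ + 1) ℤ.- (k ℤ.- + 1) ℤ.* (+ m)) (ℤ.pos-+ 1 r) ⟩
  ((+ M) ℤ.- (+ a) ℤ.+ + 1) ℤ.- ((+ 1 ℤ.+ + r) ℤ.- + 1) ℤ.* (+ m)
    ≡⟨ regroup (+ L) (+ r) (+ a) (+ M) (+ m) ⟩
  + L ℤ.+ ((+ 1 ℤ.+ + M) ℤ.- (+ L ℤ.+ + r ℤ.* + m ℤ.+ + a))
    ≡⟨ cong (λ k → + L ℤ.+ (k ℤ.- (+ L ℤ.+ + r ℤ.* + m ℤ.+ + a))) eqℤ ⟩
  + L ℤ.+ ((+ L ℤ.+ + r ℤ.* + m ℤ.+ + a) ℤ.- (+ L ℤ.+ + r ℤ.* + m ℤ.+ + a))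
    ≡⟨ cong (ℤ._+_ (+ L)) (ℤ.+-inverseʳ (+ L ℤ.+ + r ℤ.* + m ℤ.+ + a)) ⟩
  + L ℤ.+ + 0
    ≡⟨ ℤ.+-identityʳ (+ L) ⟩
  + L ∎)
  where
  open ≡-Reasoning
  regroup : ∀ L R A M k → ((M ℤ.- A ℤ.+ + 1) ℤ.- ((+ 1 ℤ.+ R) ℤ.- + 1) ℤ.* k)
                        ≡ L ℤ.+ ((+ 1 ℤ.+ M) ℤ.- (L ℤ.+ R ℤ.* k ℤ.+ A))
  regroup = ℤ-solve-∀
  eqℤ : + 1 ℤ.+ + M ≡ + L ℤ.+ + r ℤ.* + m ℤ.+ + a
  eqℤ = begin
    + 1 ℤ.+ + M                 ≡⟨ ℤ.pos-+ 1 M ⟨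
    + suc M                     ≡⟨ cong +_ eq ⟨
    + (L + r * m + a)           ≡⟨ ℤ.pos-+ (L + r * m) a ⟩
    + (L + r * m) ℤ.+ + a       ≡⟨ cong (ℤ._+ + a) (ℤ.pos-+ L (r * m)) ⟩
    + L ℤ.+ + (r * m) ℤ.+ + a   ≡⟨ cong (λ k → + L ℤ.+ k ℤ.+ + a) (ℤ.pos-* r m) ⟩
    + L ℤ.+ + r ℤ.* + m ℤ.+ + a ∎

∸≤⇒≤+ : ∀ {n m l} → n ∸ m ≤ l → n ≤ l + m
∸≤⇒≤+ {n} {m} {l} n∸m≤l =
  ≤-trans (m≤n+m∸n n m) (≤-trans (+-monoʳ-≤ m n∸m≤l) (≤-reflexive (+-comm m l)))

≤+⇒∸≤ : ∀ {n m l} → n ≤ l + m → n ∸ m ≤ l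
≤+⇒∸≤ {n} {m} {l} n≤l+m = m≤n+o⇒m∸n≤o n m (subst (n ≤_) (+-comm l m) n≤l+m)

module Gaps (m : ℕ) where

  Near : ℕ → ℕ → Set
  Near x v = x ≤ v + m × v ≤ x + m

  ∣-∣≤⇒Near : ∀ x v → ∣ x - v ∣ ≤ m → Near x v
  ∣-∣≤⇒Near zero    v       d = z≤n , d
  ∣-∣≤⇒Near (suc x) zero    d = d , z≤n
  ∣-∣≤⇒Near (suc x) (suc v) d = map s≤s s≤s (∣-∣≤⇒Near x v d)

  Near⇒∣-∣≤ : ∀ x v → Near x v → ∣ x - v ∣ ≤ m
  Near⇒∣-∣≤ zero    v       (_ , v≤) = v≤
  Near⇒∣-∣≤ (suc x) zero    (x≤ , _) = x≤
  Near⇒∣-∣≤ (suc x) (suc v) (s≤s x≤ , s≤s v≤) = Near⇒∣-∣≤ x v (x≤ , v≤)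

  Near-refl : ∀ x → Near x x
  Near-refl x = m≤m+n x m , m≤m+n x m

  infix 4 _≪_
  _≪_ : ℕ → ℕ → Set
  a ≪ b = a + m < b

  ¬Near : ∀ x v → ¬ Near x v → v ≪ x ⊎ x ≪ v
  ¬Near x v ¬near with v + m <? x | x + m <? v
  ... | yes v+m<x | _         = inj₁ v+m<x
  ... | no _      | yes x+m<v = inj₂ x+m<v
  ... | no v+m≮x  | no x+m≮v  = ⊥-elim (¬near (≮⇒≥ v+m≮x , ≮⇒≥ x+m≮v))

  ≪⇒< : ∀ {a b} → a ≪ b → a < b
  ≪⇒< {a} a≪b = ≤-<-trans (m≤m+n a m) a≪b

  Sparse : List ℕ → Set
  Sparse = AllPairs _≪_

  lastFrom : ℕ → List ℕ → ℕ
  lastFrom a []      = a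
  lastFrom a (b ∷ r) = lastFrom b r

  lastFrom-∷ʳ : ∀ a r b → lastFrom a (r ∷ʳ b) ≡ b
  lastFrom-∷ʳ a []      b = refl
  lastFrom-∷ʳ a (c ∷ r) b = lastFrom-∷ʳ c r b

  last≡lastFrom : ∀ a r → L⁺.last (a ∷ r) ≡ lastFrom a r
  last≡lastFrom a r with List.initLast r
  ... | []          = refl
  ... | r′ List.∷ʳ′ b = sym (lastFrom-∷ʳ a r′ b)

  lastFrom∈ : ∀ a r → lastFrom a r ∈ a ∷ r
  lastFrom∈ a []      = here refl
  lastFrom∈ a (b ∷ r) = there (lastFrom∈ b r)

  Sparse⇒head≤ : ∀ {a r} → Sparse (a ∷ r) → All (a ≤_) (a ∷ r)
  Sparse⇒head≤ (h ∷ _) = ≤-refl ∷ All.map (<⇒≤ ∘ ≪⇒<) h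

  Sparse⇒≤last : ∀ {a r} → Sparse (a ∷ r) → All (_≤ lastFrom a r) (a ∷ r)
  Sparse⇒≤last {r = []}    _       = ≤-refl ∷ []
  Sparse⇒≤last {r = _ ∷ _} (h ∷ t) with Sparse⇒≤last t
  ... | b≤last ∷ rest = ≤-trans (<⇒≤ (≪⇒< (All.head h))) b≤last ∷ b≤last ∷ rest

  Free : List ℕ → ℕ → Set
  Free J x = All (λ c → c ≤ x ⊎ x ≪ c) J

  Sparse⇒Free : ∀ {J c} → Sparse J → c ∈ J → Free J c
  Sparse⇒Free {J} {c} sparse c∈J = All.tabulate λ {d} d∈J → side d d∈J
    where
    side : ∀ d → d ∈ J → d ≤ c ⊎ c ≪ d
    side d d∈J with d ≟ c
    ... | yes refl = inj₁ ≤-refl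
    ... | no d≢c   = Sum.map₁ (<⇒≤ ∘ ≪⇒<) (AllPairs-either sparse d∈J c∈J d≢c)

  Free-pred : ∀ {J x} → suc x ∉ J → Free J (suc x) → Free J x
  Free-pred {[]}    _    []                 = []
  Free-pred {_ ∷ _} x∉J (inj₁ c≤ ∷ free) =
    inj₁ (s≤s⁻¹ (≤∧≢⇒< c≤ (λ c≡ → x∉J (here (sym c≡))))) ∷ Free-pred (x∉J ∘ there) free
  Free-pred {_ ∷ _} x∉J (inj₂ x≪ ∷ free) = inj₂ (<-trans (n<1+n _) x≪) ∷ Free-pred (x∉J ∘ there) free

  gap : ℕ → ℕ → ℕ
  gap a b = b ∸ m ∸ a

  block : ℕ → ℕ → List ℕ
  block a b = applyUpTo (_+_ a) (gap a b)

  +gap : ∀ {a b} → a ≪ b → a + gap a b ≡ b ∸ m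
  +gap {a} a≪b = m+[n∸m]≡n (m+n≤o⇒m≤o∸n a (<⇒≤ a≪b))

  ∈-block⁻ : ∀ {a b x} → a ≪ b → x ∈ block a b → a ≤ x × x ≪ b
  ∈-block⁻ {a} {b} a≪b x∈ with ∈-applyUpTo⁻ (_+_ a) x∈
  ... | i , i<gap , refl = m≤m+n a i , m≤o∸n⇒m+n≤o (suc (a + i)) m≤b a+i<b∸m
    where
    a+i<b∸m : a + i < b ∸ m
    a+i<b∸m = subst (a + i <_) (+gap a≪b) (+-monoʳ-< a i<gap)
    m≤b : m ≤ b
    m≤b = ≤-trans (m≤n+m m a) (<⇒≤ a≪b)

  ∈-block⁺ : ∀ {a b x} → a ≪ b → a ≤ x → x ≪ b → x ∈ block a b
  ∈-block⁺ {a} {b} {x} a≪b a≤x x≪b =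
    subst (_∈ block a b) (m+[n∸m]≡n a≤x) (∈-applyUpTo⁺ (_+_ a) x∸a<gap)
    where
    x∸a<gap : x ∸ a < gap a b
    x∸a<gap = +-cancelˡ-< a (x ∸ a) (gap a b)
                (subst₂ _<_ (sym (m+[n∸m]≡n a≤x)) (sym (+gap a≪b)) (m+n≤o⇒m≤o∸n (suc x) x≪b))

  greedy : ℕ → List ℕ → List ℕ
  greedy a []      = a ∷ []
  greedy a (b ∷ r) = block a b ++ greedy b r

  ∈-greedy⁻ : ∀ {a r x} → Sparse (a ∷ r) → x ∈ greedy a r →
              a ≤ x × x ≤ lastFrom a r × Free (a ∷ r) x
  ∈-greedy⁻ {r = []} _ (here refl) = ≤-refl , ≤-refl , inj₁ ≤-refl ∷ []
  ∈-greedy⁻ {a} {b ∷ r} {x} (a≪ ∷ sparse@(b≪ ∷ _)) x∈ with ∈-++⁻ (block a b) x∈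
  ... | inj₁ x∈block =
    let a≤x , x≪b = ∈-block⁻ (All.head a≪) x∈block in
    a≤x , ≤-trans (<⇒≤ (≪⇒< x≪b)) (All.head (Sparse⇒≤last sparse)) ,
    inj₁ a≤x ∷ inj₂ x≪b ∷ All.map (λ b≪c → inj₂ (<-trans x≪b (≪⇒< b≪c))) b≪
  ... | inj₂ x∈rest =
    let b≤x , x≤last , free = ∈-greedy⁻ sparse x∈rest
        a≤x = ≤-trans (<⇒≤ (≪⇒< (All.head a≪))) b≤x in
    a≤x , x≤last , inj₁ a≤x ∷ free

  ∈-greedy⁺ : ∀ {a r x} → Sparse (a ∷ r) → a ≤ x → x ≤ lastFrom a r → Free (a ∷ r) x →
              x ∈ greedy a r
  ∈-greedy⁺ {r = []} _ a≤x x≤a _ = here (≤-antisym x≤a a≤x)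
  ∈-greedy⁺ {a} {b ∷ r} {x} (a≪ ∷ sparse) a≤x x≤last (_ ∷ free@(b-free ∷ _)) with x <? b
  ... | yes x<b = ∈-++⁺ˡ (∈-block⁺ (All.head a≪) a≤x x≪b)
    where
    x≪b : x ≪ b
    x≪b = [ ⊥-elim ∘ <⇒≱ x<b , id ] b-free
  ... | no x≮b = ∈-++⁺ʳ (block a b) (∈-greedy⁺ sparse (≮⇒≥ x≮b) x≤last free)

  head∈greedy : ∀ {a r} → Sparse (a ∷ r) → a ∈ greedy a r
  head∈greedy sparse@(a≪ ∷ _) =
    ∈-greedy⁺ sparse ≤-refl (All.head (Sparse⇒≤last sparse)) (inj₁ ≤-refl ∷ All.map inj₂ a≪)

  greedy-near : ∀ {a r y} → Sparse (a ∷ r) → a ≤ y → y ≤ lastFrom a r + m →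
                ∃ λ x → x ∈ greedy a r × Near y x
  greedy-near {a} {[]} {y} _ a≤y y≤a+m = a , here refl , y≤a+m , ≤-trans a≤y (m≤m+n y m)
  greedy-near {a} {b ∷ r} {y} (a≪ ∷ sparse@(b≪ ∷ _)) a≤y y≤last+m with y <? b
  ... | no y≮b =
    let x , x∈ , near = greedy-near sparse (≮⇒≥ y≮b) y≤last+m in
    x , ∈-++⁺ʳ (block a b) x∈ , near
  ... | yes y<b with y + m <? b
  ...   | yes y≪b = y , ∈-++⁺ˡ (∈-block⁺ (All.head a≪) a≤y y≪b) , Near-refl y
  ...   | no y+m≮b =
    b , ∈-++⁺ʳ (block a b) (head∈greedy sparse) , ≤-trans (<⇒≤ y<b) (m≤m+n b m) , ≮⇒≥ y+m≮b

  greedy-sorted : ∀ {a r} → Sparse (a ∷ r) → AllPairs _<_ (greedy a r)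
  greedy-sorted {r = []} _ = [] ∷ []
  greedy-sorted {a} {b ∷ r} (a≪ ∷ sparse) =
    AllPairs.++⁺ (applyUpTo-sorted (_+_ a) (gap a b) (+-monoʳ-< a)) (greedy-sorted sparse)
      (All.tabulate λ x∈block → All.tabulate λ y∈rest →
        <-≤-trans (≪⇒< (proj₂ (∈-block⁻ (All.head a≪) x∈block))) (proj₁ (∈-greedy⁻ sparse y∈rest)))

  length-greedy : ∀ {a r} → Sparse (a ∷ r) → length (greedy a r) + length r * m + a ≡ suc (lastFrom a r)
  length-greedy {r = []} _ = refl
  length-greedy {a} {b ∷ r} (a≪ ∷ sparse) = begin
    length (block a b ++ greedy b r) + (m + length r * m) + a
      ≡⟨ cong (λ l → l + (m + length r * m) + a) (length-++ (block a b)) ⟩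
    (length (block a b) + length (greedy b r)) + (m + length r * m) + a
      ≡⟨ cong (λ l → (l + length (greedy b r)) + (m + length r * m) + a) (length-applyUpTo (_+_ a) (gap a b)) ⟩
    (gap a b + length (greedy b r)) + (m + length r * m) + a
      ≡⟨ regroup (gap a b) (length (greedy b r)) (length r * m) a m ⟩
    length (greedy b r) + length r * m + (gap a b + a + m)
      ≡⟨ cong (_+_ (length (greedy b r) + length r * m)) gap+a+m≡b ⟩
    length (greedy b r) + length r * m + b
      ≡⟨ length-greedy sparse ⟩
    suc (lastFrom b r) ∎
    where
    open ≡-Reasoning
    regroup : ∀ k l x y z → (k + l) + (z + x) + y ≡ l + x + (k + y + z)
    regroup = solve-∀
    gap+a+m≡b : gap a b + a + m ≡ b
    gap+a+m≡b = trans (cong (_+ m) (trans (+-comm (gap a b) a) (+gap (All.head a≪))))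
                      (m∸n+n≡m (≤-trans (m≤n+m m a) (<⇒≤ (All.head a≪))))

  length-greedy≡formula : ∀ {a r} → Sparse (a ∷ r) → + length (greedy a r) ≡ formula m (a ∷ r)
  length-greedy≡formula {a} {r} sparse rewrite last≡lastFrom a r =
    count≡formula m _ a (length r) _ (length-greedy sparse)

module Independence (n m : ℕ) where

  open Gaps m

  Sparse⇒IndepSet : ∀ {a r} → Sparse (a ∷ r) → All (InV n) (a ∷ r) → IndepSet n m (a ∷ r)
  Sparse⇒IndepSet {a} {r} sparse I⊆V = Linked-sorted sparse , I⊆V , far
    where
    Linked-sorted : ∀ {xs} → Sparse xs → Linked _<_ xs
    Linked-sorted []                  = Linked.[]
    Linked-sorted (_ ∷ [])            = Linked.[-]
    Linked-sorted (x≪ ∷ sparse@(_ ∷ _)) = ≪⇒< (All.head x≪) Linked.∷ Linked-sorted sparse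
    ≪⇒far : ∀ {x y} → x ≪ y → m < ∣ x - y ∣
    ≪⇒far {x} {y} x≪y = ≰⇒> (λ d → <⇒≱ x≪y (proj₂ (∣-∣≤⇒Near x y d)))
    far : ∀ x y → x ∈ a ∷ r → y ∈ a ∷ r → x ≢ y → m < ∣ x - y ∣
    far x y x∈ y∈ x≢y = [ ≪⇒far , subst (m <_) (∣-∣-comm y x) ∘ ≪⇒far ] (AllPairs-either sparse x∈ y∈ x≢y)

  IndepSet⇒Sparse : ∀ {a r} → IndepSet n m (a ∷ r) → Sparse (a ∷ r)
  IndepSet⇒Sparse (linked , _ , far) = sorted⇒Sparse (Linked⇒AllPairs <-trans linked) far
    where
    sorted⇒Sparse : ∀ {xs} → AllPairs _<_ xs →
                    (∀ x y → x ∈ xs → y ∈ xs → x ≢ y → m < ∣ x - y ∣) → Sparse xs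
    sorted⇒Sparse []          _   = []
    sorted⇒Sparse {x ∷ _} (x< ∷ sorted) far =
      All.tabulate x≪ ∷ sorted⇒Sparse sorted (λ u v u∈ v∈ → far u v (there u∈) (there v∈))
      where
      x≪ : ∀ {y} → y ∈ _ → x ≪ y
      x≪ {y} y∈ with ¬Near x y (<⇒≱ (far x y (here refl) (there y∈) (<⇒≢ (All.lookup x< y∈))) ∘ Near⇒∣-∣≤ x y)
      ... | inj₁ y≪x = ⊥-elim (<-asym (All.lookup x< y∈) (≪⇒< y≪x))
      ... | inj₂ x≪y = x≪y

module PrivateNeighbours (n m : ℕ) where

  open Gaps m

  InN? : ∀ v x → Dec (InN n m v x)
  InN? v x = ((1 ≤? x) ×-dec (x ≤? n)) ×-dec (∣ x - v ∣ ≤? m)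

  Near⇒InN : ∀ {v x} → InV n x → Near x v → InN n m v x
  Near⇒InN {v} {x} x∈V near = x∈V , Near⇒∣-∣≤ x v near

  InN⇒Near : ∀ {v x} → InN n m v x → Near x v
  InN⇒Near {v} {x} (_ , d) = ∣-∣≤⇒Near x v d

  ≪⇒¬InN : ∀ {v x} → v ≪ x → ¬ InN n m v x
  ≪⇒¬InN v≪x inN = <⇒≱ v≪x (proj₁ (InN⇒Near inN))

  module _ {S : List ℕ} where

    InPN-unique : ∀ {i j x} → InPN n m S i x → InPN n m S j x → i ≡ j
    InPN-unique {i} {j} (inNᵢ , firstᵢ) (inNⱼ , firstⱼ) with Fin.<-cmp i j
    ... | tri< i<j _ _ = ⊥-elim (firstⱼ i i<j inNᵢ)
    ... | tri≈ _ i≡j _ = i≡j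
    ... | tri> _ _ j<i = ⊥-elim (firstᵢ j j<i inNⱼ)

    InPN⇒first : ∀ {i j x} → InPN n m S j x → InN n m (lookup S i) x → toℕ j ≤ toℕ i
    InPN⇒first {i} {j} (_ , firstⱼ) inNᵢ with toℕ i <? toℕ j
    ... | yes i<j = ⊥-elim (firstⱼ i i<j inNᵢ)
    ... | no i≮j  = ≮⇒≥ i≮j

    footprinter : (∀ x → InV n x → Σ (Fin (length S)) λ i → InN n m (lookup S i) x) →
                  ∀ x → InV n x → Σ (Fin (length S)) λ i → InPN n m S i x
    footprinter dominates x x∈V
      with Fin.¬∀⟶∃¬-smallest _ (λ i → ¬ InN n m (lookup S i) x) (λ i → ¬? (InN? (lookup S i) x))
             (λ none → let i , inN = dominates x x∈V in none i inN)
    ... | i , ¬¬inN , before = i , decidable-stable (InN? (lookup S i) x) ¬¬inN , earlier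
      where
      earlier : ∀ j → toℕ j < toℕ i → ¬ InN n m (lookup S j) x
      earlier j j<i = subst (λ k → ¬ InN n m (lookup S k) x)
                            (Fin.toℕ-injective (trans (Fin.toℕ-inject (Fin.fromℕ< j<i)) (Fin.toℕ-fromℕ< j<i)))
                            (before (Fin.fromℕ< j<i))

    module _ (sorted : AllPairs _<_ S) where

      sorted⇒InPN : ∀ {i x} → InN n m (lookup S i) x →
                    (∀ {y} → y ∈ S → y < lookup S i → ¬ InN n m y x) → InPN n m S i x
      sorted⇒InPN {i} inN smaller = inN , λ j j<i → smaller (∈-lookup j) (AllPairs-lookup sorted j i j<i)

      InPN-sorted⇒ : ∀ {i x} → InPN n m S i x → ∀ {y} → y ∈ S → y < lookup S i → ¬ InN n m y x
      InPN-sorted⇒ {i} (_ , first) y∈S y<sᵢ with Fin.<-cmp (Any.index y∈S) i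
      ... | tri< j<i _ _ = subst (λ y → ¬ InN n m y _) (sym (lookup-index y∈S)) (first _ j<i)
      ... | tri≈ _ refl _ = ⊥-elim (<-irrefl (lookup-index y∈S) y<sᵢ)
      ... | tri> _ _ i<j =
        ⊥-elim (<-asym y<sᵢ (subst (lookup S i <_) (sym (lookup-index y∈S)) (AllPairs-lookup sorted i _ i<j)))

      sorted⇒FootSelf : ∀ {x} → x ∈ S → InV n x → (∀ {y} → y ∈ S → y < x → ¬ InN n m y x) →
                        FootSelf n m S x
      sorted⇒FootSelf {x} x∈S x∈V smaller =
        Any.index x∈S , sym (lookup-index x∈S) ,
        sorted⇒InPN (subst (λ v → InN n m v x) (lookup-index x∈S) (Near⇒InN x∈V (Near-refl x)))
                    (λ y∈S y< → smaller y∈S (subst (_ <_) (sym (lookup-index x∈S)) y<))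

  dominator-index : ∀ {S v x} → v ∈ S → InN n m v x → Σ (Fin (length S)) λ i → InN n m (lookup S i) x
  dominator-index v∈S inN = Any.index v∈S , subst (λ v → InN n m v _) (lookup-index v∈S) inN

module GreedyLegal (n m : ℕ) {a : ℕ} {r : List ℕ} where

  open Gaps m
  open PrivateNeighbours n m

  S : List ℕ
  S = greedy a r

  module _ (sparse : Sparse (a ∷ r)) (I⊆V : All (InV n) (a ∷ r)) where

    sorted : AllPairs _<_ S
    sorted = greedy-sorted sparse

    1≤a : 1 ≤ a
    1≤a = proj₁ (All.head I⊆V)

    last≤n : lastFrom a r ≤ n
    last≤n = proj₂ (All.lookup I⊆V (lastFrom∈ a r))

    greedy⊆V : All (InV n) S
    greedy⊆V = All.tabulate λ x∈ →
      let a≤x , x≤last , _ = ∈-greedy⁻ sparse x∈ in ≤-trans 1≤a a≤x , ≤-trans x≤last last≤n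

    greedy-dominates : a ≤ m + 1 → n ≤ lastFrom a r + m →
                       ∀ y → InV n y → Σ (Fin (length S)) λ i → InN n m (lookup S i) y
    greedy-dominates a≤m+1 n≤last+m y y∈V with y <? a
    ... | yes y<a = dominator-index (head∈greedy sparse) (Near⇒InN y∈V near-a)
      where
      near-a : Near y a
      near-a = ≤-trans (<⇒≤ y<a) (m≤m+n a m) ,
               ≤-trans a≤m+1 (subst (_≤ y + m) (+-comm 1 m) (+-monoˡ-≤ m (proj₁ y∈V)))
    ... | no y≮a =
      let x , x∈ , near = greedy-near sparse (≮⇒≥ y≮a) (≤-trans (proj₂ y∈V) n≤last+m) in
      dominator-index x∈ (Near⇒InN y∈V near)

    greedy⊆V-at : ∀ i → InV n (lookup S i)
    greedy⊆V-at i = All.lookup greedy⊆V (∈-lookup i)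

    -- the private neighbour of the i-th vertex is its right end s + m, or n if that overshoots
    greedy-private : ∀ i → ∃ λ x → InPN n m S i x
    greedy-private i with lookup S i + m ≤? n
    ... | yes s+m≤n = lookup S i + m ,
          sorted⇒InPN sorted
            (Near⇒InN (≤-trans 1≤s (m≤m+n _ m) , s+m≤n) (≤-refl , ≤-trans (m≤m+n _ m) (m≤m+n _ m)))
                             (λ _ y<s → ≪⇒¬InN (+-monoˡ-< m y<s))
      where
      1≤s : 1 ≤ lookup S i
      1≤s = proj₁ (greedy⊆V-at i)
    ... | no s+m≰n = n ,
          sorted⇒InPN sorted
            (Near⇒InN (≤-trans 1≤s s≤n , ≤-refl) (<⇒≤ (≰⇒> s+m≰n) , ≤-trans s≤n (m≤m+n n m)))
                             (λ y∈ y<s → ≪⇒¬InN (<-≤-trans (y≪last y∈ y<s) last≤n))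
      where
      1≤s : 1 ≤ lookup S i
      1≤s = proj₁ (greedy⊆V-at i)
      s≤n : lookup S i ≤ n
      s≤n = proj₂ (greedy⊆V-at i)
      y≪last : ∀ {y} → y ∈ S → y < lookup S i → y ≪ lastFrom a r
      y≪last y∈ y<s with All.lookup (proj₂ (proj₂ (∈-greedy⁻ sparse y∈))) (lastFrom∈ a r)
      ... | inj₁ last≤y =
        ⊥-elim (<⇒≱ (<-≤-trans y<s (proj₁ (proj₂ (∈-greedy⁻ sparse (∈-lookup i))))) last≤y)
      ... | inj₂ y≪last = y≪last

    greedy-FootSelf : ∀ {c} → c ∈ a ∷ r → FootSelf n m S c
    greedy-FootSelf {c} c∈I = sorted⇒FootSelf sorted c∈S (All.lookup I⊆V c∈I) smaller
      where
      c∈S : c ∈ S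
      c∈S = ∈-greedy⁺ sparse (All.lookup (Sparse⇒head≤ sparse) c∈I) (All.lookup (Sparse⇒≤last sparse) c∈I)
                      (Sparse⇒Free sparse c∈I)
      smaller : ∀ {y} → y ∈ S → y < c → ¬ InN n m y c
      smaller y∈S y<c with All.lookup (proj₂ (proj₂ (∈-greedy⁻ sparse y∈S))) c∈I
      ... | inj₁ c≤y = ⊥-elim (<⇒≱ y<c c≤y)
      ... | inj₂ y≪c = ≪⇒¬InN y≪c

    -- a vertex of S outside I has its predecessor in S too, which (as m ≥ 1) dominates it earlier
    FootSelf⇒∈ : 1 ≤ m → ∀ {x} → FootSelf n m S x → x ∈ a ∷ r
    FootSelf⇒∈ 1≤m {x} (i , sᵢ≡x , inPN) with x ∈? a ∷ r
    ... | yes x∈I = x∈I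
    ... | no x∉I with ∈-greedy⁻ sparse (subst (_∈ S) sᵢ≡x (∈-lookup i))
    FootSelf⇒∈ 1≤m {zero}   _ | no _   | a≤x , _ = ⊥-elim (<⇒≱ (≤-trans 1≤a a≤x) z≤n)
    FootSelf⇒∈ 1≤m {suc x′} (i , sᵢ≡x , inPN) | no x∉I | a≤x , x≤last , free =
      ⊥-elim (InPN-sorted⇒ sorted inPN x′∈S (≤-reflexive (sym sᵢ≡x)) x′-dominates)
      where
      x′∈S : x′ ∈ S
      x′∈S = ∈-greedy⁺ sparse (s≤s⁻¹ (≤∧≢⇒< a≤x (λ a≡ → x∉I (here (sym a≡)))))
                       (≤-trans (n≤1+n x′) x≤last)
                       (Free-pred x∉I free)
      x′-dominates : InN n m x′ (suc x′)
      x′-dominates = Near⇒InN (subst (InV n) sᵢ≡x (greedy⊆V-at i))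
        (subst (_≤ x′ + m) (+-comm x′ 1) (+-monoʳ-≤ x′ 1≤m) , ≤-trans (n≤1+n x′) (m≤m+n _ m))

    greedy-legal : a ≤ m + 1 → n ≤ lastFrom a r + m → LegalDom n m S
    greedy-legal a≤m+1 n≤last+m =
      AllPairs.map <⇒≢ sorted , greedy⊆V , greedy-dominates a≤m+1 n≤last+m , greedy-private

    greedy-ISeq : 1 ≤ m → ISeq n m S (a ∷ r)
    greedy-ISeq 1≤m x = mk⇔ (FootSelf⇒∈ 1≤m) greedy-FootSelf

module Admissibility (n m : ℕ) {a : ℕ} {r : List ℕ}
                     (sparse : Gaps.Sparse m (a ∷ r)) (I⊆V : All (InV n) (a ∷ r)) where

  open Gaps m

  last : ℕ
  last = lastFrom a r

  record Admissible (z : ℕ) : Set where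
    field
      vertex   : InV n z
      free     : Free (a ∷ r) z
      free-of-n : last ≪ n → n ≤ z ⊎ z ≪ n
      within   : z ≤ last ⊎ last ≪ n

  admissible-inner : ∀ {z} → InV n z → Free (a ∷ r) z → z + m ≤ n → (last ≪ n → z + m ≢ n) →
                     Admissible z
  admissible-inner {z} z∈V free z+m≤n z+m≢n = record
    { vertex = z∈V ; free = free
    ; free-of-n = λ last≪n → inj₂ (≤∧≢⇒< z+m≤n (z+m≢n last≪n))
    ; within = Sum.map₂ (λ z≰last → <-≤-trans (+-monoˡ-< m (≰⇒> z≰last)) z+m≤n) (toSum (z ≤? last)) }

  self-admissible : ∀ {c} → c ∈ a ∷ r → Admissible c
  self-admissible c∈I = record
    { vertex = All.lookup I⊆V c∈I ; free = Sparse⇒Free sparse c∈I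
    ; free-of-n = λ last≪n → inj₂ (≤-<-trans (+-monoˡ-≤ m c≤last) last≪n)
    ; within = inj₁ c≤last }
    where
    c≤last : _ ≤ last
    c≤last = All.lookup (Sparse⇒≤last sparse) c∈I

  end-admissible : last ≪ n → Admissible n
  end-admissible last≪n = record
    { vertex = ≤-trans (proj₁ (All.head I⊆V)) (proj₂ (All.head I⊆V)) , ≤-refl
    ; free = All.tabulate λ c∈I → inj₁ (proj₂ (All.lookup I⊆V c∈I))
    ; free-of-n = λ _ → inj₁ ≤-refl
    ; within = inj₂ last≪n }

  -- b ∷ t is I, with 1 prepended when a > m + 1 and n appended when last + m < n
  record Completion (b : ℕ) (t : List ℕ) : Set where
    field
      members   : ∀ {c} → c ∈ b ∷ t → c ∈ a ∷ r ⊎ c ≡ 1 ⊎ (c ≡ n × last ≪ n)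
      first≡    : b ≡ 1 ⊎ (b ≡ a × a ≤ m + 1)
      last≡     : (lastFrom b t ≡ n × last ≪ n) ⊎ (lastFrom b t ≡ last × n ≤ last + m)

  admissible⇒∈greedy : ∀ {b t z} → Completion b t → Sparse (b ∷ t) → Admissible z → z ∈ greedy b t
  admissible⇒∈greedy {b} {t} {z} J sparseJ adm =
    ∈-greedy⁺ sparseJ b≤z z≤lastJ (All.tabulate (free-J ∘ members))
    where
    open Completion J
    open Admissible adm
    b≤z : b ≤ z
    b≤z with first≡
    ... | inj₁ refl = proj₁ vertex
    ... | inj₂ (refl , b≤m+1) with All.head free
    ...   | inj₁ b≤z = b≤z
    ...   | inj₂ z≪b =
      ⊥-elim (<⇒≱ (+-cancelʳ-< m z 1 (<-≤-trans z≪b (subst (b ≤_) (+-comm m 1) b≤m+1))) (proj₁ vertex))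
    z≤lastJ : z ≤ lastFrom b t
    z≤lastJ with last≡
    ... | inj₁ (lastJ≡n , _) = subst (z ≤_) (sym lastJ≡n) (proj₂ vertex)
    ... | inj₂ (lastJ≡last , n≤last+m) =
      subst (z ≤_) (sym lastJ≡last) ([ id , (λ last≪n → ⊥-elim (<⇒≱ last≪n n≤last+m)) ] within)
    free-J : ∀ {c} → c ∈ a ∷ r ⊎ c ≡ 1 ⊎ (c ≡ n × last ≪ n) → c ≤ z ⊎ z ≪ c
    free-J (inj₁ c∈I)                  = All.lookup free c∈I
    free-J (inj₂ (inj₁ refl))          = inj₁ (proj₁ vertex)
    free-J (inj₂ (inj₂ (refl , last≪n))) = free-of-n last≪n

  self-completion : a ≤ m + 1 → n ≤ last + m → Completion a r
  self-completion a≤m+1 n≤last+m = record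
    { members = inj₁ ; first≡ = inj₂ (refl , a≤m+1) ; last≡ = inj₂ (refl , n≤last+m) }

  module _ {b t} (J : Completion b t) where

    open Completion J

    Completion⇒first≤ : b ≤ m + 1
    Completion⇒first≤ with first≡
    ... | inj₁ refl = m≤n+m 1 m
    ... | inj₂ (refl , a≤m+1) = a≤m+1

    Completion⇒n≤last+m : n ≤ lastFrom b t + m
    Completion⇒n≤last+m with last≡
    ... | inj₁ (lastJ≡n , _) = subst (λ l → n ≤ l + m) (sym lastJ≡n) (m≤m+n n m)
    ... | inj₂ (lastJ≡last , n≤last+m) = subst (λ l → n ≤ l + m) (sym lastJ≡last) n≤last+m

    Completion⊆V : All (InV n) (b ∷ t)
    Completion⊆V = All.tabulate (c∈V ∘ members)
      where
      1≤n : 1 ≤ n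
      1≤n = ≤-trans (proj₁ (All.head I⊆V)) (proj₂ (All.head I⊆V))
      c∈V : ∀ {c} → c ∈ a ∷ r ⊎ c ≡ 1 ⊎ (c ≡ n × last ≪ n) → InV n c
      c∈V (inj₁ c∈I)            = All.lookup I⊆V c∈I
      c∈V (inj₂ (inj₁ refl))    = ≤-refl , 1≤n
      c∈V (inj₂ (inj₂ (refl , _))) = 1≤n , ≤-refl

  prepended : Σ ℕ λ b → Σ (List ℕ) λ t → lastFrom b t ≡ last × (∀ {c} → c ∈ b ∷ t → c ∈ a ∷ r ⊎ c ≡ 1)
              × (b ≡ 1 ⊎ (b ≡ a × a ≤ m + 1)) × Sparse (b ∷ t)
  prepended with m + 1 <? a
  ... | yes m+1<a = 1 , a ∷ r , refl , (λ { (here c≡1) → inj₂ c≡1 ; (there c∈I) → inj₁ c∈I }) , inj₁ refl ,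
        All.map (λ a≤c → ≤-<-trans (≤-reflexive (+-comm 1 m)) (<-≤-trans m+1<a a≤c)) (Sparse⇒head≤ sparse) ∷ sparse
  ... | no m+1≮a = a , r , refl , inj₁ , inj₂ (refl , ≮⇒≥ m+1≮a) , sparse

  completion : Σ ℕ λ b → Σ (List ℕ) λ t → Completion b t × Sparse (b ∷ t)
  completion with prepended
  ... | b , t , lastJ≡last , members₁ , first≡ , sparseJ with last + m <? n
  ...   | no ¬last≪n = b , t ,
          record { members = Sum.map₂ inj₁ ∘ members₁ ; first≡ = first≡
                 ; last≡ = inj₂ (lastJ≡last , ≮⇒≥ ¬last≪n) } ,
          sparseJ
  ...   | yes last≪n = b , t ∷ʳ n ,
          record { members = members′ ; first≡ = first≡ ; last≡ = inj₁ (lastFrom-∷ʳ b t n , last≪n) } ,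
          AllPairs.++⁺ sparseJ ([] ∷ [])
            (All.map (λ c≤ → ≪n (subst (_ ≤_) lastJ≡last c≤) ∷ []) (Sparse⇒≤last sparseJ))
    where
    ≪n : ∀ {c} → c ≤ last → c ≪ n
    ≪n c≤last = ≤-<-trans (+-monoˡ-≤ m c≤last) last≪n
    members′ : ∀ {c} → c ∈ (b ∷ t) ++ n ∷ [] → c ∈ a ∷ r ⊎ c ≡ 1 ⊎ (c ≡ n × last ≪ n)
    members′ c∈ with ∈-++⁻ (b ∷ t) c∈
    ... | inj₁ c∈J = Sum.map₂ inj₁ (members₁ c∈J)
    ... | inj₂ (here c≡n) = inj₂ (inj₂ (c≡n , last≪n))

module UpperBound (n m : ℕ) (1≤m : 1 ≤ m) {a : ℕ} {r : List ℕ}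
                  (sparse : Gaps.Sparse m (a ∷ r)) (I⊆V : All (InV n) (a ∷ r)) (S : List ℕ) (legal : LegalDom n m S)
                  (iseq : ISeq n m S (a ∷ r)) where

  open Gaps m
  open PrivateNeighbours n m

  s : Fin (length S) → ℕ
  s = lookup S

  PN : Fin (length S) → ℕ → Set
  PN = InPN n m S

  s∈V : ∀ i → InV n (s i)
  s∈V i = All.lookup (proj₁ (proj₂ legal)) (∈-lookup i)

  self-footprint : ∀ {c} → c ∈ a ∷ r → Σ (Fin (length S)) λ k → s k ≡ c × PN k c
  self-footprint {c} = Equivalence.from (iseq c)

  open Admissibility n m sparse I⊆V

  self⊎earlier : ∀ i → PN i (s i) ⊎
                 (¬ PN i (s i) × Σ (Fin (length S)) λ j → toℕ j < toℕ i × InN n m (s j) (s i))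
  self⊎earlier i with footprinter {S = S} (proj₁ (proj₂ (proj₂ legal))) (s i) (s∈V i)
  ... | k , pnₖ with k Fin.≟ i
  ...   | yes refl = inj₁ pnₖ
  ...   | no k≢i = inj₂ ((λ pnᵢ → k≢i (InPN-unique {S = S} pnₖ pnᵢ)) , k , k<i , proj₁ pnₖ)
    where
    k<i : toℕ k < toℕ i
    k<i = ≤∧≢⇒< (InPN⇒first {S = S} pnₖ (Near⇒InN (s∈V i) (Near-refl (s i)))) (k≢i ∘ Fin.toℕ-injective)

  -- c would have to be its own footprint, yet it is dominated by s i, or dominates x before s i does
  no-I-near-both : ∀ {i x c} → PN i x → ¬ PN i (s i) → c ∈ a ∷ r → Near x c → Near c (s i) → ⊥
  no-I-near-both {i} {x} {c} pnᵢ ¬self c∈I x~c c~sᵢ =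
    case m≤n⇒m<n∨m≡n i≤k of λ where
      (inj₁ i<k) → proj₂ pnₖ i i<k (Near⇒InN (All.lookup I⊆V c∈I) c~sᵢ)
      (inj₂ toℕi≡k) → let i≡k = Fin.toℕ-injective toℕi≡k in
        ¬self (subst (PN i) (sym (trans (cong s i≡k) sₖ≡c)) (subst (λ j → PN j c) (sym i≡k) pnₖ))
    where
    k : Fin (length S)
    k = proj₁ (self-footprint c∈I)
    sₖ≡c : s k ≡ c
    sₖ≡c = proj₁ (proj₂ (self-footprint c∈I))
    pnₖ : PN k c
    pnₖ = proj₂ (proj₂ (self-footprint c∈I))
    i≤k : toℕ i ≤ toℕ k
    i≤k = InPN⇒first {S = S} pnᵢ (Near⇒InN (proj₁ (proj₁ pnᵢ)) (subst (Near x) (sym sₖ≡c) x~c))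

  free-window : ∀ {i x z} → PN i x → ¬ PN i (s i) →
                (∀ {c} → z < c → c ≤ z + m → Near x c × Near c (s i)) → Free (a ∷ r) z
  free-window {i} {x} {z} pnᵢ ¬self window = All.tabulate λ {c} c∈I → side c∈I
    where
    side : ∀ {c} → c ∈ a ∷ r → c ≤ z ⊎ z ≪ c
    side {c} c∈I with c ≤? z | z + m <? c
    ... | yes c≤z | _       = inj₁ c≤z
    ... | no _    | yes z≪c = inj₂ z≪c
    ... | no c≰z  | no ¬z≪c  =
      ⊥-elim (uncurry (no-I-near-both pnᵢ ¬self c∈I) (window (≰⇒> c≰z) (≮⇒≥ ¬z≪c)))

  -- z codes a private neighbour of s i: z itself (left, end) or z + m (right)
  data Shape (i : Fin (length S)) (z : ℕ) : Set where
    left  : PN i z → z ≤ s i → s i ≤ z + m → Shape i z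
    right : PN i (z + m) → s i < z + m → Shape i z
    end   : PN i z → z ≡ n → Shape i z

  right-left : ∀ {i j z} → PN i (z + m) → s i < z + m → PN j z → z ≤ s j → s j ≤ z + m → i ≡ j
  right-left {i} {j} {z} pnᵢ sᵢ<z+m pnⱼ z≤sⱼ sⱼ≤z+m = Fin.toℕ-injective (≤-antisym
    (InPN⇒first {S = S} pnᵢ (Near⇒InN (proj₁ (proj₁ pnᵢ)) (+-monoˡ-≤ m z≤sⱼ , ≤-trans sⱼ≤z+m (m≤m+n _ m))))
    (InPN⇒first {S = S} pnⱼ (Near⇒InN (proj₁ (proj₁ pnⱼ)) (z≤sᵢ+m , <⇒≤ sᵢ<z+m))))
    where
    z≤sᵢ+m : z ≤ s i + m
    z≤sᵢ+m = ≤-trans (+-cancelʳ-≤ m z (s i) (proj₁ (InN⇒Near (proj₁ pnᵢ)))) (m≤m+n _ m)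

  ¬right-end : ∀ {i z} → PN i (z + m) → z ≢ n
  ¬right-end {i} {z} pnᵢ refl =
    <⇒≱ (subst (_≤ z + m) (+-comm z 1) (+-monoʳ-≤ z 1≤m)) (proj₂ (proj₁ (proj₁ pnᵢ)))

  Shape-injective : ∀ {i j z} → Shape i z → Shape j z → i ≡ j
  Shape-injective (left  pᵢ _ _)     (left  pⱼ _ _)     = InPN-unique {S = S} pᵢ pⱼ
  Shape-injective (left  pᵢ _ _)     (end   pⱼ _)       = InPN-unique {S = S} pᵢ pⱼ
  Shape-injective (end   pᵢ _)       (left  pⱼ _ _)     = InPN-unique {S = S} pᵢ pⱼ
  Shape-injective (end   pᵢ _)       (end   pⱼ _)       = InPN-unique {S = S} pᵢ pⱼ
  Shape-injective (right pᵢ _)       (right pⱼ _)       = InPN-unique {S = S} pᵢ pⱼ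
  Shape-injective (right pᵢ sᵢ<)     (left  pⱼ z≤ ≤z+m) = right-left pᵢ sᵢ< pⱼ z≤ ≤z+m
  Shape-injective (left  pᵢ z≤ ≤z+m) (right pⱼ sⱼ<)     = sym (right-left pⱼ sⱼ< pᵢ z≤ ≤z+m)
  Shape-injective (right pᵢ _)       (end   _ z≡n)     = ⊥-elim (¬right-end pᵢ z≡n)
  Shape-injective (end   _ z≡n)     (right pⱼ _)       = ⊥-elim (¬right-end pⱼ z≡n)

  module _ {i j : Fin (length S)} (j<i : toℕ j < toℕ i) (sⱼ~sᵢ : InN n m (s j) (s i))
           {x : ℕ} (pnᵢ : PN i x) (¬self : ¬ PN i (s i)) where

    ¬Near-sⱼ : ¬ Near x (s j)
    ¬Near-sⱼ x~sⱼ = proj₂ pnᵢ j j<i (Near⇒InN (proj₁ (proj₁ pnᵢ)) x~sⱼ)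

    sᵢ~x : Near x (s i)
    sᵢ~x = InN⇒Near (proj₁ pnᵢ)

    left-admissible : x ≤ s i → Admissible x
    left-admissible x≤sᵢ = admissible-inner (proj₁ (proj₁ pnᵢ)) free (<⇒≤ x+m<n) (λ _ → <⇒≢ x+m<n)
      where
      x≪sⱼ : x ≪ s j
      x≪sⱼ with ¬Near x (s j) ¬Near-sⱼ
      ... | inj₁ sⱼ≪x = ⊥-elim (<⇒≱ sⱼ≪x (≤-trans x≤sᵢ (proj₁ (InN⇒Near sⱼ~sᵢ))))
      ... | inj₂ x≪sⱼ = x≪sⱼ
      x+m<n : x + m < n
      x+m<n = <-≤-trans x≪sⱼ (proj₂ (s∈V j))
      free : Free (a ∷ r) x
      free = free-window pnᵢ ¬self λ x<c c≤x+m →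
        (≤-trans (<⇒≤ x<c) (m≤m+n _ m) , c≤x+m) ,
        (≤-trans c≤x+m (+-monoˡ-≤ m x≤sᵢ) , ≤-trans (proj₂ sᵢ~x) (+-monoˡ-≤ m (<⇒≤ x<c)))

    right-witness : s i < x → (last ≪ n → x ≢ n) → Σ ℕ λ z → Shape i z × Admissible z
    right-witness sᵢ<x x≢n =
      z , right pn-z+m sᵢ<z+m , admissible-inner z∈V free z+m≤n (λ last≪n → x≢n last≪n ∘ trans (sym z+m≡x))
      where
      sⱼ≪x : s j ≪ x
      sⱼ≪x with ¬Near x (s j) ¬Near-sⱼ
      ... | inj₁ sⱼ≪x = sⱼ≪x
      ... | inj₂ x≪sⱼ = ⊥-elim (<⇒≱ x≪sⱼ (≤-trans (proj₂ (InN⇒Near sⱼ~sᵢ)) (+-monoˡ-≤ m (<⇒≤ sᵢ<x))))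
      z : ℕ
      z = x ∸ m
      z+m≡x : z + m ≡ x
      z+m≡x = m∸n+n≡m (≤-trans (m≤n+m m (s j)) (<⇒≤ sⱼ≪x))
      pn-z+m : PN i (z + m)
      pn-z+m = subst (PN i) (sym z+m≡x) pnᵢ
      sᵢ<z+m : s i < z + m
      sᵢ<z+m = subst (s i <_) (sym z+m≡x) sᵢ<x
      z+m≤n : z + m ≤ n
      z+m≤n = subst (_≤ n) (sym z+m≡x) (proj₂ (proj₁ (proj₁ pnᵢ)))
      z∈V : InV n z
      z∈V = ≤-trans (proj₁ (s∈V j)) (<⇒≤ (+-cancelʳ-< m (s j) z (subst (s j + m <_) (sym z+m≡x) sⱼ≪x)))
          , ≤-trans (m≤m+n z m) z+m≤n
      free : Free (a ∷ r) z
      free = free-window pnᵢ ¬self λ z<c c≤z+m →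
        let c≤x = subst (_ ≤_) z+m≡x c≤z+m
            x<c+m = subst (_< _) z+m≡x (+-monoˡ-< m z<c) in
        (<⇒≤ x<c+m , ≤-trans c≤x (m≤m+n x m)) ,
        (≤-trans c≤x (proj₁ sᵢ~x) , <⇒≤ (<-trans sᵢ<x x<c+m))

  witness : ∀ i → Σ ℕ λ z → Shape i z × Admissible z
  witness i with self⊎earlier i
  ... | inj₁ pnᵢ =
    s i , left pnᵢ ≤-refl (m≤m+n _ m) , self-admissible (Equivalence.to (iseq (s i)) (i , refl , pnᵢ))
  ... | inj₂ (¬self , j , j<i , sⱼ~sᵢ) with proj₂ (proj₂ (proj₂ legal)) i
  ...   | x , pnᵢ with x ≤? s i
  ...     | yes x≤sᵢ =
    x , left pnᵢ x≤sᵢ (proj₂ (InN⇒Near (proj₁ pnᵢ))) , left-admissible j<i sⱼ~sᵢ pnᵢ ¬self x≤sᵢ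
  ...     | no x≰sᵢ with x ≟ n | last + m <? n
  ...       | yes refl | yes last≪n = n , end pnᵢ refl , end-admissible last≪n
  ...       | yes refl | no ¬last≪n = right-witness j<i sⱼ~sᵢ pnᵢ ¬self (≰⇒> x≰sᵢ) (λ last≪n _ → ¬last≪n last≪n)
  ...       | no x≢n   | _         = right-witness j<i sⱼ~sᵢ pnᵢ ¬self (≰⇒> x≰sᵢ) (λ _ → x≢n)

  length-bound : ∀ {b t} → Completion b t → Sparse (b ∷ t) → length S ≤ length (greedy b t)
  length-bound J sparseJ =
    injection⇒≤length _ point point-injective (λ i → admissible⇒∈greedy J sparseJ (proj₂ (proj₂ (witness i))))
    where
    point : Fin (length S) → ℕ
    point = proj₁ ∘ witness
    point-injective : ∀ i j → point i ≡ point j → i ≡ j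
    point-injective i j same =
      Shape-injective (proj₁ (proj₂ (witness i))) (subst (Shape j) (sym same) (proj₁ (proj₂ (witness j))))

lemma6 : (m n : ℕ) → 1 ≤ m → m + 2 ≤ n →
    ((I : List⁺ ℕ) → InTilde n m I → GammaGrIs n m I (formula m I))
    × ((I : List⁺ ℕ) → IndepSet n m I → Σ (List⁺ ℕ) λ I' → InTilde n m I' × GammaGrLe n m I I')
lemma6 m n 1≤m _ = extremal , dominated
  where
  open Gaps m
  open Independence n m
  open GreedyLegal n m

  extremal : (I : List⁺ ℕ) → InTilde n m I → GammaGrIs n m I (formula m I)
  extremal (a ∷ r) (indep@(_ , I⊆V , _) , a≤m+1 , n∸m≤last) =
    (greedy a r , greedy-legal sparse I⊆V a≤m+1 n≤last+m , greedy-ISeq sparse I⊆V 1≤m ,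
     length-greedy≡formula sparse) ,
    λ S legal iseq → subst (+ length S ℤ.≤_) (length-greedy≡formula sparse)
                       (ℤ.+≤+ (UpperBound.length-bound n m 1≤m sparse I⊆V S legal iseq I-complete sparse))
    where
    sparse : Sparse (a ∷ r)
    sparse = IndepSet⇒Sparse indep
    n≤last+m : n ≤ lastFrom a r + m
    n≤last+m = ∸≤⇒≤+ (subst (n ∸ m ≤_) (last≡lastFrom a r) n∸m≤last)
    open Admissibility n m sparse I⊆V
    I-complete : Completion a r
    I-complete = self-completion a≤m+1 n≤last+m

  dominated : (I : List⁺ ℕ) → IndepSet n m I → Σ (List⁺ ℕ) λ I' → InTilde n m I' × GammaGrLe n m I I'
  dominated (a ∷ r) indep@(_ , I⊆V , _) with Admissibility.completion n m (IndepSet⇒Sparse indep) I⊆V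
  ... | b , t , I′ , sparseJ =
    (b ∷ t) , (Sparse⇒IndepSet sparseJ J⊆V , Completion⇒first≤ I′ , n∸m≤last) ,
    λ S legal iseq → greedy b t , greedy-legal sparseJ J⊆V (Completion⇒first≤ I′) (Completion⇒n≤last+m I′) ,
                     greedy-ISeq sparseJ J⊆V 1≤m , UpperBound.length-bound n m 1≤m sparse I⊆V S legal iseq I′ sparseJ
    where
    sparse : Sparse (a ∷ r)
    sparse = IndepSet⇒Sparse indep
    open Admissibility n m sparse I⊆V
    J⊆V : All (InV n) (b ∷ t)
    J⊆V = Completion⊆V I′
    n∸m≤last : n ∸ m ≤ L⁺.last (b ∷ t)
    n∸m≤last = subst (n ∸ m ≤_) (sym (last≡lastFrom b t)) (≤+⇒∸≤ (Completion⇒n≤last+m I′))
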